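{- Let $D_3$ be a binary relational system such that any two vertices $v,w$ for which $[v]$ and $[w]$ belong to the same connected component of $\mathscr P_{D_3}$ have the same total degree. Then there exists a binary relational system $D_4$ such that $D_3\leq_{\mathrm{End}}D_4$ and all vertices of $D_4$ have the same total degree.
   Context: A binary relational system is a finite set with finitely many binary relations (coloured arcs); homomorphisms preserve each relation; $\mathrm{End}(D)$ is the endomorphism monoid. The total degree of a vertex is its number of incoming plus outgoing arcs over all colours. $v\sim w$ (same endomorphism class $[v]$) if there are endomorphisms $f,g$ with $f(v)=w$, $g(w)=v$. $\mathscr P_D$ is the poset on $V(D)/\!\sim$ with $[v]\preceq[w]$ iff some endomorphism maps $v$ to $w$; its connected components are those of its comparability graph. $D$ is an induced subsystem of $D'$ if its index set and vertex set are contained in those of $D'$, its relations are the restrictions to $V(D)$ of those of $D'$, and the other relations of $D'$ are empty on $V(D)$. $D\leq_{\mathrm{End}}D'$ means $D$ is an induced subsystem of $D'$ and $g\mapsto g|_{V(D)}$ is a bijection $\mathrm{End}(D')\to\mathrm{End}(D)$. -}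

module Defs where

open import Data.Nat using (ℕ; zero; suc; _+_; _≤_)
open import Data.Fin using (Fin; toℕ; inject≤)
open import Data.Bool using (Bool; true; false)
open import Data.List using (map; allFin)
open import Data.Nat.ListAction using (sum)
open import Data.Product using (Σ; ∃; _×_; _,_; proj₁)
open import Data.Sum using (_⊎_)
open import Relation.Binary.PropositionalEquality using (_≡_)
open import Relation.Binary.Construct.Closure.ReflexiveTransitive using (Star)

-- A binary relational system: vertex set Fin nV, index set Fin nR,
-- and for each index i a binary relation rel i on the vertices (decidable, as Bool).
record BRS : Set where
  field
    nV  : ℕ
    nR  : ℕ
    rel : Fin nR → Fin nV → Fin nV → Bool
open BRS public

IsEndo : (D : BRS) → (Fin (nV D) → Fin (nV D)) → Set
IsEndo D f = ∀ i v w → rel D i v w ≡ true → rel D i (f v) (f w) ≡ true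

Endo : BRS → Set
Endo D = Σ (Fin (nV D) → Fin (nV D)) (IsEndo D)

b2n : Bool → ℕ
b2n true  = 1
b2n false = 0

-- total degree: number of outgoing plus incoming arcs over all colours
-- (a loop counts once as outgoing and once as incoming)
totalDeg : (D : BRS) → Fin (nV D) → ℕ
totalDeg D v =
  sum (map (λ i → sum (map (λ w → b2n (rel D i v w) + b2n (rel D i w v)) (allFin (nV D))))
           (allFin (nR D)))

-- [v] ⪯ [w] in the poset P_D : some endomorphism maps v to w
Below : (D : BRS) → Fin (nV D) → Fin (nV D) → Set
Below D v w = ∃ λ (f : Endo D) → proj₁ f v ≡ w

Comparable : (D : BRS) → Fin (nV D) → Fin (nV D) → Set
Comparable D v w = Below D v w ⊎ Below D w v

-- [v] and [w] lie in the same connected component of P_D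
-- (connected in the comparability graph of P_D)
SameComponent : (D : BRS) → Fin (nV D) → Fin (nV D) → Set
SameComponent D = Star (Comparable D)

-- D ≤_End D' : D is an induced subsystem of D' (index set and vertex set of D
-- embedded as initial segments via inject≤), and restriction End(D') → End(D)
-- is a well-defined bijection.
record _≤End_ (D D' : BRS) : Set where
  field
    V≤ : nV D ≤ nV D'
    R≤ : nR D ≤ nR D'
  ιV : Fin (nV D) → Fin (nV D')
  ιV v = inject≤ v V≤
  ιR : Fin (nR D) → Fin (nR D')
  ιR i = inject≤ i R≤
  field
    rel-restrict : ∀ i v w → rel D i v w ≡ rel D' (ιR i) (ιV v) (ιV w)
    rel-other : ∀ (j : Fin (nR D')) → nR D ≤ toℕ j →
                ∀ v w → rel D' j (ιV v) (ιV w) ≡ false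
    restrict : ∀ (g : Endo D') → ∃ λ (f : Endo D) →
               ∀ v → proj₁ g (ιV v) ≡ ιV (proj₁ f v)
    restrict-inj : ∀ (g h : Endo D') → (∀ v → proj₁ g (ιV v) ≡ proj₁ h (ιV v)) →
                   ∀ x → proj₁ g x ≡ proj₁ h x
    restrict-surj : ∀ (f : Endo D) → ∃ λ (g : Endo D') →
                    ∀ v → proj₁ g (ιV v) ≡ ιV (proj₁ f v)

{-# OPTIONS --safe #-}
-- Take D together with a disjoint copy a ↦ a′ of its vertices and add height h = 1 + Σₐ deg a new
-- colours, colour j joining a to a′ exactly when j < h ∸ deg a; then a and a′ both have
-- degree deg a + (h ∸ deg a) = h. As h > deg a, colour 0 joins every a to a′, and the new
-- colours join nothing else, so an endomorphism maps each rung a → a′ to a rung: it restricts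
-- to the first copy and is determined there. Conversely an endomorphism f of D preserves
-- degrees (v and f v are comparable in P_D), so f acting on both copies preserves the new arcs.
module Submission where

open import Defs
open import Data.Fin using (Fin)
open import Data.Product using (∃; _×_)
open import Relation.Binary.PropositionalEquality using (_≡_)

open import Data.Bool using (Bool; true; false; _∧_)
open import Data.Fin using (zero; suc; toℕ; inject≤; splitAt; join; _↑ˡ_; _↑ʳ_; _≟_)
open import Data.Fin.Properties
  using (splitAt-↑ˡ; splitAt-↑ʳ; splitAt-≥; splitAt-join; join-splitAt; splitAt⁻¹-↑ˡ; splitAt⁻¹-↑ʳ; ↑ˡ-injective)
open import Data.List using (map; allFin; tabulate)
open import Data.List.Properties using (map-tabulate)
open import Data.Nat using (ℕ; zero; suc; _+_; _∸_; _≤_; _<ᵇ_; z≤n; s≤s; s≤s⁻¹)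
open import Data.Nat.ListAction using (sum)
open import Data.Nat.Properties
  using (+-0-commutativeMonoid; +-assoc; +-identityʳ; ≤-trans; m≤m+n; m≤n+m; m∸n≤m; +-∸-assoc; m+[n∸m]≡n)
open import Algebra.Properties.CommutativeMonoid.Sum +-0-commutativeMonoid
  using (sum-syntax; sum-cong-≗; sum-replicate-zero)
open import Data.Product using (_,_; proj₁; proj₂)
open import Data.Sum as Sum using (_⊎_; inj₁; inj₂; reduce)
open import Function using (_∘_)
open import Relation.Binary.PropositionalEquality using (_≗_; refl; sym; trans; cong; cong₂; subst; module ≡-Reasoning)
open import Relation.Binary.Construct.Closure.ReflexiveTransitive using (ε; _◅_)
open import Relation.Nullary.Decidable using (yes; no; does; dec-true)

open ≡-Reasoning

sum-tabulate : ∀ {n} (f : Fin n → ℕ) → sum (tabulate f) ≡ ∑[ i < n ] f i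
sum-tabulate {zero}  f = refl
sum-tabulate {suc n} f = cong (f zero +_) (sum-tabulate (f ∘ suc))

sum-map-allFin : ∀ {n} (f : Fin n → ℕ) → sum (map f (allFin n)) ≡ ∑[ i < n ] f i
sum-map-allFin f = trans (cong sum (map-tabulate (λ i → i) f)) (sum-tabulate f)

∑-splitAt : ∀ m {k} (G : Fin m ⊎ Fin k → ℕ) →
            ∑[ x < m + k ] G (splitAt m x) ≡ ∑[ a < m ] G (inj₁ a) + ∑[ b < k ] G (inj₂ b)
∑-splitAt zero    G = refl
∑-splitAt (suc m) G = trans (cong (G (inj₁ zero) +_) (∑-splitAt m (G ∘ Sum.map₁ suc)))
                            (sym (+-assoc (G (inj₁ zero)) _ _))

≤-∑ : ∀ {n} (f : Fin n → ℕ) (a : Fin n) → f a ≤ ∑[ i < n ] f i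
≤-∑ f zero    = m≤m+n _ _
≤-∑ f (suc a) = ≤-trans (≤-∑ (f ∘ suc) a) (m≤n+m _ _)

∑-<ᵇ : ∀ {m k} → m ≤ k → ∑[ j < k ] b2n (toℕ j <ᵇ m) ≡ m
∑-<ᵇ {zero}  {zero}  z≤n       = refl
∑-<ᵇ {zero}  {suc k} z≤n       = sum-replicate-zero k
∑-<ᵇ {suc m} {suc k} (s≤s m≤k) = cong suc (∑-<ᵇ m≤k)

∑-δˡ : ∀ {n} (a : Fin n) (p : Fin n → Bool) → ∑[ b < n ] b2n (does (a ≟ b) ∧ p b) ≡ b2n (p a)
∑-δˡ {suc n} zero    p = trans (cong (b2n (p zero) +_) (sum-replicate-zero n)) (+-identityʳ _)
∑-δˡ         (suc a) p = ∑-δˡ a (p ∘ suc)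

∑-δʳ : ∀ {n} (a : Fin n) (p : Fin n → Bool) → ∑[ b < n ] b2n (does (b ≟ a) ∧ p b) ≡ b2n (p a)
∑-δʳ {suc n} zero    p = trans (cong (b2n (p zero) +_) (sum-replicate-zero n)) (+-identityʳ _)
∑-δʳ         (suc a) p = ∑-δʳ a (p ∘ suc)

inject≤≡↑ˡ : ∀ {m k} (i : Fin m) .(p : m ≤ m + k) → inject≤ i p ≡ i ↑ˡ k
inject≤≡↑ˡ zero    _ = refl
inject≤≡↑ˡ (suc i) p = cong suc (inject≤≡↑ˡ i (s≤s⁻¹ p))

≗-by-splitAt : ∀ {m k} {A : Set} {f g : Fin (m + k) → A} →
               (∀ a → f (a ↑ˡ k) ≡ g (a ↑ˡ k)) → (∀ b → f (m ↑ʳ b) ≡ g (m ↑ʳ b)) → f ≗ g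
≗-by-splitAt {m} {k} {f = f} {g} left right x =
  subst (λ y → f y ≡ g y) (join-splitAt m k x) (on-join (splitAt m x))
  where
  on-join : ∀ X → f (join m k X) ≡ g (join m k X)
  on-join (inj₁ a) = left a
  on-join (inj₂ b) = right b

arcs : (D : BRS) → Fin (nR D) → Fin (nV D) → Fin (nV D) → ℕ
arcs D i v w = b2n (rel D i v w) + b2n (rel D i w v)

totalDeg-∑ : (D : BRS) (v : Fin (nV D)) → totalDeg D v ≡ ∑[ i < nR D ] ∑[ w < nV D ] arcs D i v w
totalDeg-∑ D v = trans (sum-map-allFin (λ i → sum (map (arcs D i v) (allFin (nV D)))))
                       (sum-cong-≗ (λ i → sum-map-allFin (arcs D i v)))

EndoInvariantDegree : BRS → Set
EndoInvariantDegree D = ∀ (f : Endo D) v → totalDeg D (proj₁ f v) ≡ totalDeg D v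

sameComponent⇒endoInvariantDegree : (D : BRS) →
  (∀ v w → SameComponent D v w → totalDeg D v ≡ totalDeg D w) → EndoInvariantDegree D
sameComponent⇒endoInvariantDegree D constant f v = sym (constant v (proj₁ f v) (inj₁ (f , refl) ◅ ε))

module Padding (D : BRS) where

  n : ℕ
  n = nV D

  R : ℕ
  R = nR D

  deg : Fin n → ℕ
  deg = totalDeg D

  height : ℕ
  height = suc (∑[ a < n ] deg a)

  pads : Fin height → Fin n → Bool
  pads j a = toℕ j <ᵇ height ∸ deg a

  pads-zero : ∀ a → pads zero a ≡ true
  pads-zero a rewrite +-∸-assoc 1 (≤-∑ deg a) = refl

  -- inj₂ a is the copy a′ of a; the colours inj₂ j are the new ones.
  padRel : Fin R ⊎ Fin height → Fin n ⊎ Fin n → Fin n ⊎ Fin n → Bool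
  padRel (inj₁ i) (inj₁ a) (inj₁ b) = rel D i a b
  padRel (inj₁ i) (inj₂ a) (inj₂ b) = rel D i a b
  padRel (inj₂ j) (inj₁ a) (inj₂ b) = does (a ≟ b) ∧ pads j a
  padRel _        _        _        = false

  Pad : BRS
  Pad = record
    { nV  = n + n
    ; nR  = R + height
    ; rel = λ c x y → padRel (splitAt R c) (splitAt n x) (splitAt n y)
    }

  padArcs : Fin R ⊎ Fin height → Fin n ⊎ Fin n → Fin n ⊎ Fin n → ℕ
  padArcs c X Y = b2n (padRel c X Y) + b2n (padRel c Y X)

  colourDeg : Fin R ⊎ Fin height → Fin n ⊎ Fin n → ℕ
  colourDeg c X = ∑[ a < n ] padArcs c X (inj₁ a) + ∑[ b < n ] padArcs c X (inj₂ b)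

  totalDeg-Pad : ∀ x → totalDeg Pad x ≡
    ∑[ i < R ] colourDeg (inj₁ i) (splitAt n x) + ∑[ j < height ] colourDeg (inj₂ j) (splitAt n x)
  totalDeg-Pad x = begin
    totalDeg Pad x
      ≡⟨ totalDeg-∑ Pad x ⟩
    ∑[ c < R + height ] ∑[ y < n + n ] padArcs (splitAt R c) X (splitAt n y)
      ≡⟨ sum-cong-≗ (λ c → ∑-splitAt n (padArcs (splitAt R c) X)) ⟩
    ∑[ c < R + height ] colourDeg (splitAt R c) X
      ≡⟨ ∑-splitAt R (λ c → colourDeg c X) ⟩
    ∑[ i < R ] colourDeg (inj₁ i) X + ∑[ j < height ] colourDeg (inj₂ j) X
      ∎
    where
    X : Fin n ⊎ Fin n
    X = splitAt n x

  colourDeg-old : ∀ i X → colourDeg (inj₁ i) X ≡ ∑[ b < n ] arcs D i (reduce X) b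
  colourDeg-old i (inj₁ a) =
    trans (cong (∑[ b < n ] arcs D i a b +_) (sum-replicate-zero n)) (+-identityʳ _)
  colourDeg-old i (inj₂ a) = cong (_+ ∑[ b < n ] arcs D i a b) (sum-replicate-zero n)

  colourDeg-new : ∀ j X → colourDeg (inj₂ j) X ≡ b2n (pads j (reduce X))
  colourDeg-new j (inj₁ a) = begin
    colourDeg (inj₂ j) (inj₁ a)
      ≡⟨ cong (_+ ∑[ b < n ] padArcs (inj₂ j) (inj₁ a) (inj₂ b)) (sum-replicate-zero n) ⟩
    ∑[ b < n ] (b2n (does (a ≟ b) ∧ pads j a) + 0)
      ≡⟨ sum-cong-≗ (λ b → +-identityʳ (b2n (does (a ≟ b) ∧ pads j a))) ⟩
    ∑[ b < n ] b2n (does (a ≟ b) ∧ pads j a)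
      ≡⟨ ∑-δˡ a (λ _ → pads j a) ⟩
    b2n (pads j a)
      ∎
  colourDeg-new j (inj₂ a) =
    trans (cong₂ _+_ (∑-δʳ a (λ b → pads j b)) (sum-replicate-zero n)) (+-identityʳ (b2n (pads j a)))

  Pad-regular : ∀ x → totalDeg Pad x ≡ height
  Pad-regular x = begin
    totalDeg Pad x
      ≡⟨ totalDeg-Pad x ⟩
    ∑[ i < R ] colourDeg (inj₁ i) X + ∑[ j < height ] colourDeg (inj₂ j) X
      ≡⟨ cong₂ _+_ (sum-cong-≗ (λ i → colourDeg-old i X)) (sum-cong-≗ (λ j → colourDeg-new j X)) ⟩
    ∑[ i < R ] ∑[ b < n ] arcs D i a b + ∑[ j < height ] b2n (pads j a)
      ≡⟨ cong₂ _+_ (sym (totalDeg-∑ D a)) (∑-<ᵇ (m∸n≤m height (deg a))) ⟩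
    deg a + (height ∸ deg a)
      ≡⟨ m+[n∸m]≡n (≤-trans (≤-∑ deg a) (m≤n+m _ 1)) ⟩
    height
      ∎
    where
    X : Fin n ⊎ Fin n
    X = splitAt n x
    a : Fin n
    a = reduce X

  rel-↑ˡ : ∀ i x y → rel Pad (i ↑ˡ height) x y ≡ padRel (inj₁ i) (splitAt n x) (splitAt n y)
  rel-↑ˡ i x y = cong (λ c → padRel c (splitAt n x) (splitAt n y)) (splitAt-↑ˡ R i height)

  rel-↑ʳ : ∀ j x y → rel Pad (R ↑ʳ j) x y ≡ padRel (inj₂ j) (splitAt n x) (splitAt n y)
  rel-↑ʳ j x y = cong (λ c → padRel c (splitAt n x) (splitAt n y)) (splitAt-↑ʳ R height j)

  rel-old : ∀ i a b → rel Pad (i ↑ˡ height) (a ↑ˡ n) (b ↑ˡ n) ≡ rel D i a b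
  rel-old i a b rewrite rel-↑ˡ i (a ↑ˡ n) (b ↑ˡ n) | splitAt-↑ˡ n a n | splitAt-↑ˡ n b n = refl

  zero-rung : ∀ a → rel Pad (R ↑ʳ zero) (a ↑ˡ n) (n ↑ʳ a) ≡ true
  zero-rung a rewrite rel-↑ʳ zero (a ↑ˡ n) (n ↑ʳ a) | splitAt-↑ˡ n a n | splitAt-↑ʳ n n a
                   | dec-true (a ≟ a) refl = pads-zero a

  padRel⇒rung : ∀ j X Y → padRel (inj₂ j) X Y ≡ true → ∃ λ a → X ≡ inj₁ a × Y ≡ inj₂ a
  padRel⇒rung j (inj₁ a) (inj₂ b) h with a ≟ b
  padRel⇒rung j (inj₁ a) (inj₂ b) h  | yes refl = a , refl , refl
  padRel⇒rung j (inj₁ a) (inj₂ b) () | no _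
  padRel⇒rung j (inj₁ a) (inj₁ b) ()
  padRel⇒rung j (inj₂ a) (inj₁ b) ()
  padRel⇒rung j (inj₂ a) (inj₂ b) ()

  module Restriction (g : Fin (n + n) → Fin (n + n)) (g-endo : IsEndo Pad g) where

    rung-image : ∀ a → ∃ λ c → splitAt n (g (a ↑ˡ n)) ≡ inj₁ c × splitAt n (g (n ↑ʳ a)) ≡ inj₂ c
    rung-image a = padRel⇒rung zero _ _ (trans (sym (rel-↑ʳ zero _ _)) (g-endo _ _ _ (zero-rung a)))

    restriction : Fin n → Fin n
    restriction a = proj₁ (rung-image a)

    restriction-↑ˡ : ∀ a → g (a ↑ˡ n) ≡ restriction a ↑ˡ n
    restriction-↑ˡ a = sym (splitAt⁻¹-↑ˡ (proj₁ (proj₂ (rung-image a))))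

    restriction-↑ʳ : ∀ a → g (n ↑ʳ a) ≡ n ↑ʳ restriction a
    restriction-↑ʳ a = sym (splitAt⁻¹-↑ʳ (proj₂ (proj₂ (rung-image a))))

    restriction-isEndo : IsEndo D restriction
    restriction-isEndo i a b h = begin
      rel D i (restriction a) (restriction b)
        ≡⟨ rel-old i (restriction a) (restriction b) ⟨
      rel Pad (i ↑ˡ height) (restriction a ↑ˡ n) (restriction b ↑ˡ n)
        ≡⟨ cong₂ (rel Pad (i ↑ˡ height)) (restriction-↑ˡ a) (restriction-↑ˡ b) ⟨
      rel Pad (i ↑ˡ height) (g (a ↑ˡ n)) (g (b ↑ˡ n))
        ≡⟨ g-endo (i ↑ˡ height) (a ↑ˡ n) (b ↑ˡ n) (trans (rel-old i a b) h) ⟩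
      true
        ∎

  module Extension (f : Fin n → Fin n) (f-endo : IsEndo D f) (f-deg : ∀ a → deg (f a) ≡ deg a) where

    padRel-map : ∀ c X Y → padRel c X Y ≡ true → padRel c (Sum.map f f X) (Sum.map f f Y) ≡ true
    padRel-map (inj₁ i) (inj₁ a) (inj₁ b) = f-endo i a b
    padRel-map (inj₁ i) (inj₂ a) (inj₂ b) = f-endo i a b
    padRel-map (inj₂ j) (inj₁ a) (inj₂ b) h with a ≟ b
    padRel-map (inj₂ j) (inj₁ a) (inj₂ b) h  | yes refl
      rewrite dec-true (f a ≟ f a) refl | f-deg a = h
    padRel-map (inj₂ j) (inj₁ a) (inj₂ b) () | no _
    padRel-map (inj₁ i) (inj₁ a) (inj₂ b) ()
    padRel-map (inj₁ i) (inj₂ a) (inj₁ b) ()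
    padRel-map (inj₂ j) (inj₁ a) (inj₁ b) ()
    padRel-map (inj₂ j) (inj₂ a) (inj₁ b) ()
    padRel-map (inj₂ j) (inj₂ a) (inj₂ b) ()

    extension : Fin (n + n) → Fin (n + n)
    extension x = join n n (Sum.map f f (splitAt n x))

    extension-isEndo : IsEndo Pad extension
    extension-isEndo c x y h
      rewrite splitAt-join n n (Sum.map f f (splitAt n x)) | splitAt-join n n (Sum.map f f (splitAt n y)) =
      padRel-map (splitAt R c) (splitAt n x) (splitAt n y) h

    extension-↑ˡ : ∀ a → extension (a ↑ˡ n) ≡ f a ↑ˡ n
    extension-↑ˡ a rewrite splitAt-↑ˡ n a n = refl

  open Restriction
  open Extension

  endo-≗-from-↑ˡ : ∀ ((g , g-endo) (h , h-endo) : Endo Pad) → (∀ a → g (a ↑ˡ n) ≡ h (a ↑ˡ n)) → g ≗ h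
  endo-≗-from-↑ˡ (g , g-endo) (h , h-endo) left = ≗-by-splitAt left right
    where
    same-restriction : ∀ a → restriction g g-endo a ≡ restriction h h-endo a
    same-restriction a = ↑ˡ-injective n _ _
      (trans (sym (restriction-↑ˡ g g-endo a)) (trans (left a) (restriction-↑ˡ h h-endo a)))
    right : ∀ b → g (n ↑ʳ b) ≡ h (n ↑ʳ b)
    right b = begin
      g (n ↑ʳ b)                       ≡⟨ restriction-↑ʳ g g-endo b ⟩
      n ↑ʳ restriction g g-endo b      ≡⟨ cong (n ↑ʳ_) (same-restriction b) ⟩
      n ↑ʳ restriction h h-endo b      ≡⟨ restriction-↑ʳ h h-endo b ⟨
      h (n ↑ʳ b)                       ∎

  Pad-≤End : EndoInvariantDegree D → D ≤End Pad
  Pad-≤End invariant = record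
    { V≤            = m≤m+n n n
    ; R≤            = m≤m+n R height
    ; rel-restrict  = λ i a b → sym (ι-rel i a b)
    ; rel-other     = other-colours-empty
    ; restrict      = restrict
    ; restrict-inj  = λ g h agree →
        endo-≗-from-↑ˡ g h (λ a → subst (λ x → proj₁ g x ≡ proj₁ h x) (ι≡↑ˡ a) (agree a))
    ; restrict-surj = extend
    }
    where
    ι : Fin n → Fin (n + n)
    ι a = inject≤ a (m≤m+n n n)

    ι≡↑ˡ : ∀ a → ι a ≡ a ↑ˡ n
    ι≡↑ˡ a = inject≤≡↑ˡ a (m≤m+n n n)

    ι-rel : ∀ i a b → rel Pad (inject≤ i (m≤m+n R height)) (ι a) (ι b) ≡ rel D i a b
    ι-rel i a b rewrite inject≤≡↑ˡ i (m≤m+n R height) | ι≡↑ˡ a | ι≡↑ˡ b = rel-old i a b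

    other-colours-empty : ∀ j → R ≤ toℕ j → ∀ a b → rel Pad j (ι a) (ι b) ≡ false
    other-colours-empty j R≤j a b
      rewrite ι≡↑ˡ a | ι≡↑ˡ b | splitAt-≥ R j R≤j | splitAt-↑ˡ n a n | splitAt-↑ˡ n b n = refl

    commutes-ι : ∀ (g : Fin (n + n) → Fin (n + n)) (φ : Fin n → Fin n) → (∀ a → g (a ↑ˡ n) ≡ φ a ↑ˡ n) → ∀ a → g (ι a) ≡ ι (φ a)
    commutes-ι g φ comm a = begin
      g (ι a)        ≡⟨ cong g (ι≡↑ˡ a) ⟩
      g (a ↑ˡ n)     ≡⟨ comm a ⟩
      φ a ↑ˡ n       ≡⟨ ι≡↑ˡ (φ a) ⟨
      ι (φ a)        ∎

    restrict : ∀ (g : Endo Pad) → ∃ λ (φ : Endo D) → ∀ a → proj₁ g (ι a) ≡ ι (proj₁ φ a)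
    restrict (g , g-endo) =
      (restriction g g-endo , restriction-isEndo g g-endo) , commutes-ι g (restriction g g-endo) (restriction-↑ˡ g g-endo)

    extend : ∀ (f : Endo D) → ∃ λ (g : Endo Pad) → ∀ a → proj₁ g (ι a) ≡ ι (proj₁ f a)
    extend (f , f-endo) =
      (extension f f-endo f-deg , extension-isEndo f f-endo f-deg) ,
      commutes-ι (extension f f-endo f-deg) f (extension-↑ˡ f f-endo f-deg)
      where f-deg = invariant (f , f-endo)

lemma5p4 : (D₃ : BRS) →
    (∀ (v w : Fin (nV D₃)) → SameComponent D₃ v w → totalDeg D₃ v ≡ totalDeg D₃ w) →
    ∃ λ (D₄ : BRS) → (D₃ ≤End D₄) × (∀ (v w : Fin (nV D₄)) → totalDeg D₄ v ≡ totalDeg D₄ w)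
lemma5p4 D₃ constant-on-components =
  Pad , Pad-≤End (sameComponent⇒endoInvariantDegree D₃ constant-on-components) ,
  λ v w → trans (Pad-regular v) (sym (Pad-regular w))
  where open Padding D₃
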